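{- Let $k\ge 1$ be an integer, let $G$ be a $k$-vertex-critical graph, and let $S\subseteq V(G)$ be a homogeneous set of $G$. For each connected component $A$ of the induced subgraph $G[S]$, if $\chi(A)=m$ with $m<k$, then $A$ is an $m$-vertex-critical graph.
   Context: All graphs are finite and simple; $\chi$ denotes the chromatic number. A graph $G$ is $k$-vertex-critical if $\chi(G)=k$ and $\chi(G-v)<k$ for every $v\in V(G)$. A vertex $v$ is mixed on a set $S$ if $v$ has both a neighbor and a nonneighbor in $S$. A set $S\subseteq V(G)$ is homogeneous if no vertex of $V(G)\setminus S$ is mixed on $S$. -}

module Defs where

open import Data.Nat using (ℕ; _<_; _≤_)
open import Data.Fin using (Fin)
open import Data.Bool using (Bool; true; false; not; T)
open import Data.Product using (Σ; _×_; _,_; proj₁; ∃; ∃-syntax)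
open import Relation.Binary.PropositionalEquality using (_≡_; _≢_)
open import Relation.Nullary using (¬_)

record Graph (V : Set) : Set where
  field
    adj     : V → V → Bool
    adj-sym : ∀ u v → adj u v ≡ adj v u
    irrefl  : ∀ v → adj v v ≡ false
open Graph public

Adj : ∀ {V} → Graph V → V → V → Set
Adj G u v = T (adj G u v)

induced : ∀ {V} (G : Graph V) (P : V → Set) → Graph (Σ V P)
induced G P = record
  { adj     = λ u v → adj G (proj₁ u) (proj₁ v)
  ; adj-sym = λ u v → adj-sym G (proj₁ u) (proj₁ v)
  ; irrefl  = λ v → irrefl G (proj₁ v)
  }

_─_ : ∀ {V} (G : Graph V) → (v : V) → Graph (Σ V (λ u → u ≢ v))
_─_ {V} G v = induced G (λ u → u ≢ v)

Colorable : ∀ {V} → Graph V → ℕ → Set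
Colorable {V} G c =
  Σ (V → Fin c) λ f → ∀ u v → Adj G u v → f u ≢ f v

HasChromaticNumber : ∀ {V} → Graph V → ℕ → Set
HasChromaticNumber G m = Colorable G m × (∀ c → Colorable G c → m ≤ c)

VertexCritical : ∀ {V} → Graph V → ℕ → Set
VertexCritical {V} G k =
  HasChromaticNumber G k ×
  (∀ (v : V) → ∃[ m ] (HasChromaticNumber (G ─ v) m × m < k))

Subset : Set → Set
Subset V = V → Bool

_∈_ : ∀ {V} → V → Subset V → Set
v ∈ S = T (S v)

_∉_ : ∀ {V} → V → Subset V → Set
v ∉ S = T (not (S v))

Mixed : ∀ {V} → Graph V → V → Subset V → Set
Mixed G v S =
  (∃[ u ] (u ∈ S × Adj G v u)) × (∃[ w ] (w ∈ S × ¬ Adj G v w))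

Homogeneous : ∀ {V} → Graph V → Subset V → Set
Homogeneous {V} G S = ∀ (v : V) → v ∉ S → ¬ Mixed G v S

data WalkIn {V : Set} (G : Graph V) (P : Subset V) : V → V → Set where
  here : ∀ {u} → u ∈ P → WalkIn G P u u
  step : ∀ {u w v} → u ∈ P → Adj G u w → WalkIn G P w v → WalkIn G P u v

-- The vertex set C of a connected component of G[S]:
-- C ⊆ S, C nonempty, G[C] connected, and C is maximal, i.e. closed under
-- adjacency inside S.
IsComponentOf : ∀ {V} → Graph V → Subset V → Subset V → Set
IsComponentOf {V} G S C =
  (∀ v → v ∈ C → v ∈ S) ×
  (∃[ v ] (v ∈ C)) ×
  (∀ u v → u ∈ C → v ∈ C → WalkIn G C u v) ×
  (∀ u v → u ∈ C → v ∈ S → Adj G u v → v ∈ C)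

componentGraph : ∀ {V} (G : Graph V) (C : Subset V) → Graph (Σ V (λ v → v ∈ C))
componentGraph G C = induced G (λ v → v ∈ C)

-- Every vertex v of the component C is critical: take a colouring f of G − v with
-- fewer than k colours. If f uses fewer than χ(G[C]) colours on C − v, it colours
-- G[C] − v with fewer than χ(G[C]) colours. Otherwise recolour C injectively with
-- colours that f uses on C − v. A component of G[S] is homogeneous in G, so a vertex
-- outside C with a neighbour in C is adjacent to all of C − v and hence differs in
-- colour from every new colour on C; this colours G with fewer than k colours, which
-- is impossible. Colourability of a finite graph is decidable, so χ(G[C] − v) exists.

module Submission where

open import Defs
open import Data.Bool using (true; false; T; _∧_)
open import Data.Bool.Properties using (T?; T-∧; T-irrelevant)
open import Data.Empty using (⊥-elim)
open import Data.Fin using (Fin; zero; suc; inject≤; _≟_)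
open import Data.Fin.Properties using (any?; all?; inject≤-injective)
open import Data.List using (List; _∷_; filter; lookup; length; allFin)
open import Data.List.Membership.Propositional.Properties using (∈-filter⁺; ∈-filter⁻; ∈-allFin; ∈-lookup)
import Data.List.Relation.Unary.All as All
open import Data.List.Relation.Unary.AllPairs using (_∷_)
open import Data.List.Relation.Unary.Any using (index)
open import Data.List.Relation.Unary.Any.Properties using (lookup-index)
open import Data.List.Relation.Unary.Unique.Propositional using (Unique)
open import Data.List.Relation.Unary.Unique.Propositional.Properties using (allFin⁺; filter⁺)
open import Data.Nat using (ℕ; zero; suc; _+_; _<_; _≤_; _≤?_; s≤s)
open import Data.Nat.Properties using (≮⇒≥; <⇒≱; ≰⇒>; m<1+n⇒m<n∨m≡n; +-suc; +-identityʳ)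
open import Data.Product using (Σ; _×_; _,_; proj₁; proj₂; ∃; ∃-syntax)
open import Data.Sum using (_⊎_; inj₁; inj₂)
open import Data.Vec using (Vec; []; _∷_; tabulate) renaming (lookup to lookupᵥ)
open import Data.Vec.Properties using (lookup∘tabulate)
open import Function using (_∘_; Injective; Equivalence)
open import Relation.Binary.PropositionalEquality using (_≡_; _≢_; refl; sym; trans; cong; subst)
open import Relation.Nullary using (¬_; Dec; yes; no; ¬?)
open import Relation.Nullary.Decidable using (map′; _→-dec_; isNo; toWitnessFalse; fromWitnessFalse)
open import Relation.Unary using (Decidable)

∉⇒¬∈ : ∀ {V} {S : Subset V} {v} → v ∉ S → ¬ v ∈ S
∉⇒¬∈ {S = S} {v} v∉S with S v
... | false = λ ()

¬∈⇒∉ : ∀ {V} {S : Subset V} {v} → ¬ v ∈ S → v ∉ S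
¬∈⇒∉ {S = S} {v} v∉S with S v
... | true  = ⊥-elim (v∉S _)
... | false = _

Adj-sym : ∀ {V} (G : Graph V) {u v} → Adj G u v → Adj G v u
Adj-sym G {u} {v} = subst T (adj-sym G u v)

homogeneous-adj : ∀ {V} {G : Graph V} {S : Subset V} {v u w} → Homogeneous G S →
  v ∉ S → u ∈ S → Adj G v u → w ∈ S → Adj G v w
homogeneous-adj {G = G} {v = v} {w = w} hom v∉S u∈S vu w∈S with T? (adj G v w)
... | yes vw  = vw
... | no  ¬vw = ⊥-elim (hom v v∉S ((_ , u∈S , vu) , (w , w∈S , ¬vw)))

component-homogeneous : ∀ {V} {G : Graph V} {S C : Subset V} →
  Homogeneous G S → IsComponentOf G S C → Homogeneous G C
component-homogeneous {G = G} {S} {C} hom (C⊆S , _ , _ , closed) v v∉C ((u , u∈C , vu) , (w , w∈C , ¬vw))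
  with T? (S v)
... | yes v∈S = ∉⇒¬∈ {S = C} v∉C (closed u v u∈C v∈S (Adj-sym G vu))
... | no  v∉S = hom v (¬∈⇒∉ {S = S} v∉S) ((u , C⊆S u u∈C , vu) , (w , C⊆S w w∈C , ¬vw))

Homomorphism : ∀ {V W} → Graph V → Graph W → (V → W) → Set
Homomorphism {V} G H φ = ∀ (u v : V) → Adj G u v → Adj H (φ u) (φ v)

colorable-hom : ∀ {V W} {G : Graph V} {H : Graph W} {c} (φ : V → W) →
  Homomorphism G H φ → Colorable H c → Colorable G c
colorable-hom φ hom (f , proper) = f ∘ φ , λ u v uv → proper (φ u) (φ v) (hom u v uv)

colorable-empty : ∀ {V} (G : Graph V) → ¬ V → Colorable G 0
colorable-empty G ¬V = (λ x → ⊥-elim (¬V x)) , λ x → ⊥-elim (¬V x)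

¬colorable-zero : ∀ {V} (G : Graph V) → V → ¬ Colorable G 0
¬colorable-zero G x (f , _) with f x
... | ()

module _ {P : ℕ → Set} (P? : Decidable P) where

  private
    search : ∀ i fuel → (∀ c → c < i → ¬ P c) → P (fuel + i) →
      ∃[ c ] (P c × ∀ c′ → P c′ → c ≤ c′)
    search i fuel below p with P? i
    ... | yes pi = i , pi , λ c′ pc′ → ≮⇒≥ (λ c′<i → below c′ c′<i pc′)
    search i zero       below p | no ¬pi = ⊥-elim (¬pi p)
    search i (suc fuel) below p | no ¬pi = search (suc i) fuel below′ (subst P (sym (+-suc fuel i)) p)
      where
      below′ : ∀ c → c < suc i → ¬ P c
      below′ c c<1+i with m<1+n⇒m<n∨m≡n c<1+i
      ... | inj₁ c<i = below c c<i
      ... | inj₂ refl = ¬pi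

  least : ∀ {b} → P b → ∃[ c ] (P c × ∀ c′ → P c′ → c ≤ c′)
  least {b} pb = search 0 b (λ _ ()) (subst P (sym (+-identityʳ b)) pb)

chromatic-number : ∀ {V} (G : Graph V) → Decidable (Colorable G) →
  ∀ {b} → Colorable G b → ∃[ c ] (HasChromaticNumber G c × c ≤ b)
chromatic-number G col? colb with least col? colb
... | c , colc , minimal = c , (colc , minimal) , minimal _ colb

∃-vec? : ∀ {c} n (Q : Vec (Fin c) n → Set) → Decidable Q → Dec (Σ (Vec (Fin c) n) Q)
∃-vec? zero    Q Q? = map′ ([] ,_) (λ { ([] , q) → q }) (Q? [])
∃-vec? (suc n) Q Q? =
  map′ (λ (x , w , q) → x ∷ w , q) (λ { (x ∷ w , q) → x , w , q })
       (any? λ x → ∃-vec? n (Q ∘ (x ∷_)) (Q? ∘ (x ∷_)))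

ProperOn : ∀ {n c} → Graph (Fin n) → Subset (Fin n) → (Fin n → Fin c) → Set
ProperOn G D h = ∀ i j → i ∈ D → j ∈ D → Adj G i j → h i ≢ h j

properOn? : ∀ {n c} (G : Graph (Fin n)) (D : Subset (Fin n)) → Decidable (ProperOn {c = c} G D)
properOn? G D h = all? λ i → all? λ j →
  T? (D i) →-dec T? (D j) →-dec T? (adj G i j) →-dec ¬? (h i ≟ h j)

extend : ∀ {n} {A : Set} (D : Subset (Fin n)) → (Σ (Fin n) (_∈ D) → A) → A → Fin n → A
extend D f a i with T? (D i)
... | yes i∈D = f (i , i∈D)
... | no  _   = a

extend-proper : ∀ {n c} (G : Graph (Fin n)) (D : Subset (Fin n)) (f : Σ (Fin n) (_∈ D) → Fin c) a →
  (∀ x y → Adj (componentGraph G D) x y → f x ≢ f y) → ProperOn G D (extend D f a)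
extend-proper G D f a proper i j i∈D j∈D ij with T? (D i) | T? (D j)
... | yes i∈D′ | yes j∈D′ = proper (i , i∈D′) (j , j∈D′) ij
... | no  i∉D  | _        = ⊥-elim (i∉D i∈D)
... | _        | no  j∉D  = ⊥-elim (j∉D j∈D)

properOn-tabulate : ∀ {n c} {G : Graph (Fin n)} {D : Subset (Fin n)} (h : Fin n → Fin c) →
  ProperOn G D h → ProperOn G D (lookupᵥ (tabulate h))
properOn-tabulate h proper i j i∈D j∈D ij eq =
  proper i j i∈D j∈D ij (trans (sym (lookup∘tabulate h i)) (trans eq (lookup∘tabulate h j)))

-- A colouring of G[D] is extended to Fin n with a default colour, which needs c > 0.
colorable-induced? : ∀ {n} (G : Graph (Fin n)) (D : Subset (Fin n)) → Decidable (Colorable (componentGraph G D))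
colorable-induced? G D zero =
  map′ (colorable-empty (componentGraph G D)) (λ col x → ¬colorable-zero (componentGraph G D) x col)
       (¬? (any? (T? ∘ D)))
colorable-induced? {n} G D (suc c) =
  map′ (λ (w , proper) → (λ x → lookupᵥ w (proj₁ x)) , λ x y → proper _ _ (proj₂ x) (proj₂ y))
       (λ (f , proper) → tabulate (extend D f zero) ,
                          properOn-tabulate {G = G} {D} _ (extend-proper G D f zero proper))
       (∃-vec? n (ProperOn G D ∘ lookupᵥ) (properOn? G D ∘ lookupᵥ))

lookup-injective : ∀ {A : Set} {xs : List A} → Unique xs → ∀ i j → lookup xs i ≡ lookup xs j → i ≡ j
lookup-injective (_     ∷ _) zero    zero    _  = refl
lookup-injective (x∉xs ∷ _) zero    (suc j) eq = ⊥-elim (All.lookup x∉xs (∈-lookup j) eq)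
lookup-injective (x∉xs ∷ _) (suc i) zero    eq = ⊥-elim (All.lookup x∉xs (∈-lookup i) (sym eq))
lookup-injective (_     ∷ u) (suc i) (suc j) eq = cong suc (lookup-injective u i j eq)

module _ {X : Set} {a : ℕ} (h : X → Fin a) (image? : Decidable (λ c → ∃ λ x → h x ≡ c)) where

  private
    used : List (Fin a)
    used = filter image? (allFin a)

    rank : X → Fin (length used)
    rank x = index (∈-filter⁺ image? (∈-allFin (h x)) (x , refl))

    rank-injective : ∀ x y → rank x ≡ rank y → h x ≡ h y
    rank-injective x y eq = trans (lookup-index (∈-filter⁺ image? (∈-allFin (h x)) (x , refl)))
      (trans (cong (lookup used) eq) (sym (lookup-index (∈-filter⁺ image? (∈-allFin (h y)) (y , refl)))))

  image-dichotomy : ∀ m →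
    (Σ (Fin (suc m) → Fin a) λ e → Injective _≡_ _≡_ e × ∀ j → ∃ λ x → h x ≡ e j) ⊎
    (Σ (X → Fin m) λ r → ∀ x y → r x ≡ r y → h x ≡ h y)
  image-dichotomy m with length used ≤? m
  ... | yes ℓ≤m = inj₂ ((λ x → inject≤ (rank x) ℓ≤m) ,
          λ x y eq → rank-injective x y (inject≤-injective ℓ≤m ℓ≤m _ _ eq))
  ... | no  ℓ≰m =
    inj₁ (e , e-injective , λ j → proj₂ (∈-filter⁻ image? {xs = allFin a} (∈-lookup (inject≤ j m<ℓ))))
    where
    m<ℓ = ≰⇒> ℓ≰m
    e : Fin (suc m) → Fin a
    e j = lookup used (inject≤ j m<ℓ)
    e-injective : Injective _≡_ _≡_ e
    e-injective eq = inject≤-injective m<ℓ m<ℓ _ _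
      (lookup-injective (filter⁺ image? (allFin⁺ a)) _ _ eq)

Σ-T? : ∀ b {Q : T b → Set} → (∀ t → Dec (Q t)) → Dec (Σ (T b) Q)
Σ-T? true  Q? = map′ (_ ,_) proj₂ (Q? _)
Σ-T? false Q? = no λ ()

image-induced? : ∀ {n a} {D : Subset (Fin n)} (h : Σ (Fin n) (_∈ D) → Fin a) →
  Decidable (λ c → ∃ λ x → h x ≡ c)
image-induced? {D = D} h c =
  map′ (λ (i , i∈D , eq) → (i , i∈D) , eq) (λ ((i , i∈D) , eq) → i , i∈D , eq)
       (any? λ i → Σ-T? (D i) λ i∈D → h (i , i∈D) ≟ c)

remove : ∀ {n} → Subset (Fin n) → Fin n → Subset (Fin n)
remove C v i = C i ∧ isNo (i ≟ v)

∈-remove⁻ : ∀ {n} (C : Subset (Fin n)) {v i} → i ∈ remove C v → i ∈ C × i ≢ v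
∈-remove⁻ C t with Equivalence.to T-∧ t
... | i∈C , i≢v = i∈C , toWitnessFalse i≢v

∈-remove⁺ : ∀ {n} (C : Subset (Fin n)) {v i} → i ∈ C → i ≢ v → i ∈ remove C v
∈-remove⁺ C i∈C i≢v = Equivalence.from T-∧ (i∈C , fromWitnessFalse i≢v)

module _ {n} (G : Graph (Fin n)) (C : Subset (Fin n)) (v : Σ (Fin n) (_∈ C)) where

  private
    D = remove C (proj₁ v)

    to-remove : Σ (Σ (Fin n) (_∈ C)) (_≢ v) → Σ (Fin n) (_∈ D)
    to-remove ((i , i∈C) , i≢v) =
      i , ∈-remove⁺ C i∈C λ { refl → i≢v (cong (_ ,_) (T-irrelevant i∈C (proj₂ v))) }

    from-remove : Σ (Fin n) (_∈ D) → Σ (Σ (Fin n) (_∈ C)) (_≢ v)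
    from-remove (i , i∈D) = (i , proj₁ (∈-remove⁻ C i∈D)) , λ eq → proj₂ (∈-remove⁻ C i∈D) (cong proj₁ eq)

  colorable-remove⇒colorable-deletion : ∀ {c} →
    Colorable (componentGraph G D) c → Colorable (componentGraph G C ─ v) c
  colorable-remove⇒colorable-deletion =
    colorable-hom {G = componentGraph G C ─ v} {componentGraph G D} to-remove λ _ _ uv → uv

  deletion-colorable? : Decidable (Colorable (componentGraph G C ─ v))
  deletion-colorable? c =
    map′ colorable-remove⇒colorable-deletion
         (colorable-hom {G = componentGraph G D} {componentGraph G C ─ v} from-remove λ _ _ uv → uv)
         (colorable-induced? G D c)

module Recolouring {n} (G : Graph (Fin n)) (C : Subset (Fin n)) (homC : Homogeneous G C)
  (v : Σ (Fin n) (_∈ C)) {a} (f : Σ (Fin n) (_≢ proj₁ v) → Fin a)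
  (f-proper : ∀ x y → Adj (G ─ proj₁ v) x y → f x ≢ f y)
  {m} (g : Σ (Fin n) (_∈ C) → Fin (suc m))
  (g-proper : ∀ x y → Adj (componentGraph G C) x y → g x ≢ g y) where

  private
    D = remove C (proj₁ v)

  h : Σ (Fin n) (_∈ D) → Fin a
  h (i , i∈D) = f (i , proj₂ (∈-remove⁻ C i∈D))

  outside : ∀ {i} → ¬ i ∈ C → i ≢ proj₁ v
  outside i∉C refl = i∉C (proj₂ v)

  spread-colour : (Fin (suc m) → Fin a) → Fin n → Fin a
  spread-colour e i with T? (C i)
  ... | yes i∈C = e (g (i , i∈C))
  ... | no  i∉C = f (i , outside i∉C)

  cross-edge : (e : Fin (suc m) → Fin a) → (∀ j → ∃ λ x → h x ≡ e j) →
    ∀ {i j} (i∈C : i ∈ C) (j∉C : ¬ j ∈ C) → Adj G i j → e (g (i , i∈C)) ≢ f (j , outside j∉C)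
  cross-edge e e-used {i} i∈C j∉C ij eq with e-used (g (i , i∈C))
  ... | (w , w∈D) , hw≡egi =
    f-proper _ (w , _)
      (homogeneous-adj {G = G} homC (¬∈⇒∉ {S = C} j∉C) i∈C (Adj-sym G ij) (proj₁ (∈-remove⁻ C w∈D)))
      (sym (trans hw≡egi eq))

  spread-proper : (e : Fin (suc m) → Fin a) → Injective _≡_ _≡_ e → (∀ j → ∃ λ x → h x ≡ e j) →
    ∀ i j → Adj G i j → spread-colour e i ≢ spread-colour e j
  spread-proper e e-injective e-used i j ij with T? (C i) | T? (C j)
  ... | yes i∈C | yes j∈C = g-proper _ _ ij ∘ e-injective
  ... | yes i∈C | no  j∉C = cross-edge e e-used i∈C j∉C ij
  ... | no  i∉C | yes j∈C = cross-edge e e-used j∈C i∉C (Adj-sym G ij) ∘ sym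
  ... | no  i∉C | no  j∉C = f-proper _ _ ij

  recoloured : Colorable G a ⊎ Colorable (componentGraph G C ─ v) m
  recoloured with image-dichotomy h (image-induced? h) m
  ... | inj₁ (e , e-injective , e-used) = inj₁ (spread-colour e , spread-proper e e-injective e-used)
  ... | inj₂ (r , r-factors) =
    inj₂ (colorable-remove⇒colorable-deletion G C v (r , λ x y xy → f-proper _ _ xy ∘ r-factors x y))

homogeneous-recolouring : ∀ {n} (G : Graph (Fin n)) (C : Subset (Fin n)) {a m} →
  Homogeneous G C → (v : Σ (Fin n) (_∈ C)) →
  Colorable (G ─ proj₁ v) a → Colorable (componentGraph G C) (suc m) →
  Colorable G a ⊎ Colorable (componentGraph G C ─ v) m
homogeneous-recolouring G C homC v (f , f-proper) (g , g-proper) =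
  Recolouring.recoloured G C homC v f f-proper g g-proper

mainTheorem3 : (k : ℕ) → 1 ≤ k → (n : ℕ) → (G : Graph (Fin n)) →
    VertexCritical G k →
    (S : Subset (Fin n)) → Homogeneous G S →
    (C : Subset (Fin n)) → IsComponentOf G S C →
    (m : ℕ) → HasChromaticNumber (componentGraph G C) m → m < k →
    VertexCritical (componentGraph G C) m
mainTheorem3 k _ n G _ S _ C (_ , v , _) zero (colC , _) _ =
  ⊥-elim (¬colorable-zero (componentGraph G C) v colC)
mainTheorem3 k _ n G ((_ , χG-minimal) , critical) S homS C component (suc m) χC@(colC , _) _ =
  χC , deletion
  where
  deletion : ∀ v → ∃[ c ] (HasChromaticNumber (componentGraph G C ─ v) c × c < suc m)
  deletion v with critical (proj₁ v)
  ... | a , (colG-v , _) , a<k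
    with homogeneous-recolouring G C (component-homogeneous {G = G} {S} {C} homS component) v colG-v colC
  ... | inj₁ colG = ⊥-elim (<⇒≱ a<k (χG-minimal a colG))
  ... | inj₂ colH with chromatic-number (componentGraph G C ─ v) (deletion-colorable? G C v) colH
  ...   | c , χH , c≤m = c , χH , s≤s c≤m
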